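{- Let $(A,f)$ and $(B,g)$ be objects of $\mathbf{Gra}/P_3$ with $A$ and $B$ connected, and suppose $f[A]\subseteq g[B]$. Then there is a morphism $(A,f)\to(B,g)$ or a morphism $(B,g)\to(A,f)$ in $\mathbf{Gra}/P_3$.
   Context: Graphs are undirected and loopless; homomorphisms preserve edges. $P_3$ is the path with three edges (four vertices). The slice category $\mathbf{Gra}/P_3$ has as objects pairs $(A,f)$ with $f:A\to P_3$ a homomorphism, and morphisms $(A,f)\to(B,g)$ the homomorphisms $\psi:A\to B$ with $f=g\circ\psi$. -}

module Defs where

open import Data.Nat using (ℕ; suc)
open import Data.Bool using (Bool; true; false; T; _∨_)
open import Data.Fin using (Fin; toℕ)
open import Data.Product using (Σ; Σ-syntax; ∃; _×_; _,_)
open import Data.Sum using (_⊎_)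
open import Relation.Binary.PropositionalEquality using (_≡_)
import Data.Nat as ℕ
import Data.Fin as Fin

record Graph : Set where
  field
    n        : ℕ
    adj      : Fin n → Fin n → Bool
    adj-sym  : ∀ u v → adj u v ≡ adj v u
    loopless : ∀ v → adj v v ≡ false

open Graph public

V : Graph → Set
V G = Fin (n G)

Edge : (G : Graph) → V G → V G → Set
Edge G u v = T (adj G u v)

data Walk (G : Graph) : V G → V G → Set where
  here : ∀ {v} → Walk G v v
  step : ∀ {u w v} → Edge G u w → Walk G w v → Walk G u v

Connected : Graph → Set
Connected G = ∀ (u v : V G) → Walk G u v

record Hom (G H : Graph) : Set where
  constructor hom
  field
    map      : V G → V H
    preserve : ∀ u v → Edge G u v → Edge H (map u) (map v)

open Hom public

-- the path P₃ with three edges: vertices 0,1,2,3, i ~ j iff |i - j| = 1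
P3-adj : Fin 4 → Fin 4 → Bool
P3-adj i j = (suc (toℕ i) ℕ.≡ᵇ toℕ j) ∨ (suc (toℕ j) ℕ.≡ᵇ toℕ i)

P3-sym : ∀ u v → P3-adj u v ≡ P3-adj v u
P3-sym u v with suc (toℕ u) ℕ.≡ᵇ toℕ v | suc (toℕ v) ℕ.≡ᵇ toℕ u
... | true  | true  = _≡_.refl
... | true  | false = _≡_.refl
... | false | true  = _≡_.refl
... | false | false = _≡_.refl

P3-loopless : ∀ v → P3-adj v v ≡ false
P3-loopless Fin.zero = _≡_.refl
P3-loopless (Fin.suc Fin.zero) = _≡_.refl
P3-loopless (Fin.suc (Fin.suc Fin.zero)) = _≡_.refl
P3-loopless (Fin.suc (Fin.suc (Fin.suc Fin.zero))) = _≡_.refl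

P3 : Graph
P3 = record { n = 4 ; adj = P3-adj ; adj-sym = P3-sym ; loopless = P3-loopless }

SliceObj : Set
SliceObj = Σ Graph (λ A → Hom A P3)

SliceHom : SliceObj → SliceObj → Set
SliceHom (A , f) (B , g) =
  Σ (Hom A B) (λ ψ → ∀ (v : V A) → map f v ≡ map g (map ψ v))

ImageSub : SliceObj → SliceObj → Set
ImageSub (A , f) (B , g) = ∀ (a : V A) → Σ (V B) (λ b → map g b ≡ map f a)

{-# OPTIONS --safe #-}

-- Over P₃ every vertex has a level 0–3 and edges join consecutive levels.  If the
-- levels of A span at most three consecutive values, the connected graph B, which
-- has vertices at the lowest and highest of them, contains a strictly ascending path
-- between those levels, and A maps onto it level by level.  Otherwise A, being
-- connected, contains a zigzag 0 – 1 – 2 – (1 – 2)ᵗ – 3.  Take the least t for which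
-- A or B contains such a zigzag, say X does and Y has none shorter.  Sending each
-- vertex of Y at level 1 or 2 to the vertex of X's zigzag indexed by the least stage
-- at which a zigzag of Y reaches it (capped at t) is then a morphism Y → X.

module Submission where

open import Defs
open import Data.Bool using (T)
open import Data.Bool.Properties using (T-∨)
open import Data.Empty using (⊥-elim)
open import Data.Fin using (Fin; toℕ; zero)
open import Data.Fin.Properties using (toℕ-injective; toℕ<n; any?; ¬Fin0)
open import Data.List using (allFin)
open import Data.List.Extrema.Nat using (argmin; argmax; f[argmin]≤f[xs]; f[xs]≤f[argmax])
open import Data.List.Membership.Propositional.Properties using (∈-allFin)
open import Data.List.Relation.Unary.All using (lookup)
open import Data.Nat using (ℕ; zero; suc; _+_; _∸_; _≤_; _<_; _≟_; _≤?_; _≡ᵇ_; z≤n; s≤s)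
open import Data.Nat.Properties
  using (≡ᵇ⇒≡; ≤-refl; ≤-reflexive; ≤-trans; ≤-antisym; ≤-pred; <-asym; ≤⇒≯; <⇒≱; ≰⇒>;
         n≤1+n; m≤n⇒m≤1+n; m≤n⇒m<n∨m≡n; n≤0⇒n≡0; m+n≮n; +-suc; +-∸-assoc; m∸n+n≡m;
         n∸n≡0; suc-injective; 0≢1+n)
open import Data.Product using (∃₂; ∃-syntax; _×_; _,_; proj₁; proj₂)
open import Data.Sum using (_⊎_; inj₁; inj₂; [_,_]′)
import Data.Sum as Sum
open import Function using (_∘_; id)
open import Function.Bundles using (Equivalence)
open import Level using (Level)
open import Relation.Binary.PropositionalEquality
  using (_≡_; _≢_; refl; sym; trans; cong; subst)
open import Relation.Nullary using (¬_; yes; no; contradiction)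
open import Relation.Nullary.Decidable using (T?; _×-dec_; _⊎-dec_)
open import Relation.Unary using (Pred; Decidable)

private
  variable
    p : Level
    P : Pred ℕ p

leastUpTo : Decidable P → ℕ → ℕ
leastUpTo P? zero = zero
leastUpTo P? (suc k) with P? zero
... | yes _ = zero
... | no _  = suc (leastUpTo (P? ∘ suc) k)

leastUpTo-≤ : (P? : Decidable P) → ∀ k → leastUpTo P? k ≤ k
leastUpTo-≤ P? zero = z≤n
leastUpTo-≤ P? (suc k) with P? zero
... | yes _ = z≤n
... | no _  = s≤s (leastUpTo-≤ (P? ∘ suc) k)

leastUpTo-minimal : (P? : Decidable P) → ∀ k {t} → P t → leastUpTo P? k ≤ t
leastUpTo-minimal P? zero _ = z≤n
leastUpTo-minimal P? (suc k) {zero} p₀ with P? zero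
... | yes _  = z≤n
... | no ¬p₀ = contradiction p₀ ¬p₀
leastUpTo-minimal P? (suc k) {suc t} pt with P? zero
... | yes _ = z≤n
... | no _  = s≤s (leastUpTo-minimal (P? ∘ suc) k pt)

leastUpTo-found : (P? : Decidable P) → ∀ k → P (leastUpTo P? k) ⊎ leastUpTo P? k ≡ k
leastUpTo-found P? zero = inj₂ refl
leastUpTo-found P? (suc k) with P? zero
... | yes p₀ = inj₁ p₀
... | no _   = Sum.map id (cong suc) (leastUpTo-found (P? ∘ suc) k)

least-witness : (P? : Decidable P) → ∀ {t} → P t → ∃[ k ] (P k × ∀ s → s < k → ¬ P s)
least-witness {P = P} P? {t} pt = leastUpTo P? t , witness , below
  where
    witness : P (leastUpTo P? t)
    witness = [ id , (λ k≡t → subst P (sym k≡t) pt) ]′ (leastUpTo-found P? t)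

    below : ∀ s → s < leastUpTo P? t → ¬ P s
    below s s<k ps = <⇒≱ s<k (leastUpTo-minimal P? t ps)

span≤1 : ∀ {m n} → m ≤ n → n ≤ 1 + m → n ≡ m ⊎ n ≡ 1 + m
span≤1 m≤n n≤1+m with m≤n⇒m<n∨m≡n n≤1+m
... | inj₁ (s≤s n≤m) = inj₁ (≤-antisym n≤m m≤n)
... | inj₂ n≡1+m     = inj₂ n≡1+m

span≤2 : ∀ {m n} → m ≤ n → n ≤ 2 + m → n ≡ m ⊎ n ≡ 1 + m ⊎ n ≡ 2 + m
span≤2 m≤n n≤2+m with m≤n⇒m<n∨m≡n n≤2+m
... | inj₁ (s≤s n≤1+m) = Sum.map₂ inj₁ (span≤1 m≤n n≤1+m)
... | inj₂ n≡2+m       = inj₂ (inj₂ n≡2+m)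

m∸n≡1+[m∸1+n] : ∀ {m n} → suc n ≤ m → m ∸ n ≡ suc (m ∸ suc n)
m∸n≡1+[m∸1+n] (s≤s n≤m) = +-∸-assoc 1 n≤m

narrow-or-full : ∀ {lo hi} → hi < 4 → hi ≤ 2 + lo ⊎ lo ≡ 0 × hi ≡ 3
narrow-or-full {suc lo} hi<4 = inj₁ (≤-trans (≤-pred hi<4) (s≤s (s≤s (s≤s z≤n))))
narrow-or-full {zero} {hi} hi<4 with hi ≤? 2
... | yes hi≤2 = inj₁ hi≤2
... | no hi≰2  = inj₂ (refl , ≤-antisym (≤-pred hi<4) (≰⇒> hi≰2))

vertex? : (G : Graph) → Fin (n G) ⊎ ¬ Fin (n G)
vertex? G with n G
... | zero  = inj₂ ¬Fin0
... | suc _ = inj₁ zero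

Edge-sym : (G : Graph) → ∀ {u v} → Edge G u v → Edge G v u
Edge-sym G {u} {v} = subst T (adj-sym G u v)

P3-edge : ∀ {i j} → Edge P3 i j → suc (toℕ i) ≡ toℕ j ⊎ suc (toℕ j) ≡ toℕ i
P3-edge {i} {j} e =
  Sum.map (≡ᵇ⇒≡ _ _) (≡ᵇ⇒≡ _ _) (Equivalence.to (T-∨ {suc (toℕ i) ≡ᵇ toℕ j}) e)

module Levelled (G : Graph) (h : Hom G P3) where

  level : V G → ℕ
  level v = toℕ (map h v)

  level<4 : ∀ v → level v < 4
  level<4 v = toℕ<n (map h v)

  level-edge : ∀ {x y} → Edge G x y → level y ≡ suc (level x) ⊎ level x ≡ suc (level y)
  level-edge {x} {y} e = Sum.map sym sym (P3-edge (preserve h x y e))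

  level-range : V G → ∃₂ λ a₀ a₁ → ∀ a → level a₀ ≤ level a × level a ≤ level a₁
  level-range a =
    argmin level a vs , argmax level a vs ,
    λ x → lookup (f[argmin]≤f[xs] {f = level} a vs) (∈-allFin x) ,
          lookup (f[xs]≤f[argmax] {f = level} a vs) (∈-allFin x)
    where vs = allFin (n G)

  crossing-step : ∀ {p x z} → Edge G x z → level x ≤ p → p < level z →
                  level x ≡ p × level z ≡ suc (level x)
  crossing-step {p} e x≤p p<z with level-edge e
  ... | inj₁ z↑ = ≤-antisym x≤p (≤-pred (subst (p <_) z↑ p<z)) , z↑
  ... | inj₂ x↑ = ⊥-elim (<-asym (subst (_≤ p) x↑ x≤p) p<z)

  data Ascent : V G → V G → Set where
    []   : ∀ {x} → Ascent x x
    rise : ∀ {x y z} → Edge G x y → level y ≡ suc (level x) → Ascent y z → Ascent x z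

  Ascends : ℕ → ℕ → Set
  Ascends p q = ∃₂ λ x y → Ascent x y × level x ≡ p × level y ≡ q

  -- Past the end of the ascent its last vertex is repeated.
  rung : ∀ {x y} → Ascent x y → ℕ → V G
  rung {x} _ zero          = x
  rung {x} [] (suc d)      = x
  rung (rise _ _ r) (suc d) = rung r d

  private
    shift : ∀ {x y} d → level y ≡ suc (level x) → d + level y ≡ suc d + level x
    shift d y↑ = trans (cong (d +_) y↑) (+-suc d _)

  rung-level : ∀ {x y} (r : Ascent x y) d → d + level x ≤ level y →
               level (rung r d) ≡ d + level x
  rung-level r zero _ = refl
  rung-level [] (suc d) h = ⊥-elim (m+n≮n d _ h)
  rung-level {y = z} (rise _ y↑ r) (suc d) h =
    trans (rung-level r d (subst (_≤ level z) (sym (shift d y↑)) h)) (shift d y↑)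

  rung-edge : ∀ {x y} (r : Ascent x y) d → suc d + level x ≤ level y →
              Edge G (rung r d) (rung r (suc d))
  rung-edge [] d h = ⊥-elim (m+n≮n d _ h)
  rung-edge (rise e _ r) zero _ = e
  rung-edge {y = z} (rise _ y↑ r) (suc d) h =
    rung-edge r d (subst (_≤ level z) (sym (shift (suc d) y↑)) h)

  climb₁ : ∀ {p x y} → Walk G x y → level x ≤ p → p < level y → Ascends p (suc p)
  climb₁ here x≤p p<x = ⊥-elim (≤⇒≯ x≤p p<x)
  climb₁ {p} (step {w = z} e rest) x≤p p<y with level z ≤? p
  ... | yes z≤p = climb₁ rest z≤p p<y
  ... | no z≰p with crossing-step e x≤p (≰⇒> z≰p)
  ...   | refl , z↑ = _ , _ , rise e z↑ [] , refl , z↑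

  climb₂ : ∀ {p x y} → Walk G x y → level x ≤ p → 2 + p ≤ level y → Ascends p (2 + p)
  climb₂ here x≤p h = ⊥-elim (≤⇒≯ x≤p (≤-trans (n≤1+n _) h))
  climb₂ {p} (step {w = z} e rest) x≤p h with level z ≤? p
  ... | yes z≤p = climb₂ rest z≤p h
  ... | no z≰p with crossing-step e x≤p (≰⇒> z≰p) | rest
  ...   | refl , z↑ | here = ⊥-elim (≤⇒≯ (≤-reflexive z↑) h)
  ...   | refl , z↑ | step {w = z′} e′ rest′ with level-edge e′
  ...     | inj₁ z′↑ = _ , _ , rise e z↑ (rise e′ z′↑ []) , refl , trans z′↑ (cong suc z↑)
  ...     | inj₂ z↓  = climb₂ rest′ (≤-reflexive (suc-injective (trans (sym z↓) z↑))) h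

  ascends : ∀ {p q x y} → Walk G x y → level x ≡ p → level y ≡ q → p ≤ q → q ≤ 2 + p →
            Ascends p q
  ascends {x = x} {y} w refl refl x≤y y≤2+x with span≤2 x≤y y≤2+x
  ... | inj₁ y≡x = y , y , [] , y≡x , refl
  ... | inj₂ (inj₁ y≡1+x) =
    subst (Ascends _) (sym y≡1+x) (climb₁ w ≤-refl (≤-reflexive (sym y≡1+x)))
  ... | inj₂ (inj₂ y≡2+x) =
    subst (Ascends _) (sym y≡2+x) (climb₂ w ≤-refl (≤-reflexive (sym y≡2+x)))

  -- Reachᵢ t v: v lies at level i and ends a zigzag that starts at level 0 and
  -- falls back from level 2 to level 1 exactly t times.
  mutual
    Reach₁ : ℕ → V G → Set
    Reach₁ zero    v = level v ≡ 1 × ∃[ a ] (level a ≡ 0 × Edge G a v)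
    Reach₁ (suc t) v = level v ≡ 1 × ∃[ u ] (Reach₂ t u × Edge G u v)

    Reach₂ : ℕ → V G → Set
    Reach₂ t u = level u ≡ 2 × ∃[ v ] (Reach₁ t v × Edge G v u)

  Reach₃ : ℕ → V G → Set
  Reach₃ t w = level w ≡ 3 × ∃[ u ] (Reach₂ t u × Edge G u w)

  CrossesAt : ℕ → Set
  CrossesAt t = ∃[ w ] Reach₃ t w

  mutual
    reach₁? : ∀ t → Decidable (Reach₁ t)
    reach₁? zero    v = level v ≟ 1 ×-dec any? λ a → level a ≟ 0 ×-dec T? (adj G a v)
    reach₁? (suc t) v = level v ≟ 1 ×-dec any? λ u → reach₂? t u ×-dec T? (adj G u v)

    reach₂? : ∀ t → Decidable (Reach₂ t)
    reach₂? t u = level u ≟ 2 ×-dec any? λ v → reach₁? t v ×-dec T? (adj G v u)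

  crossesAt? : Decidable CrossesAt
  crossesAt? t = any? λ w → level w ≟ 3 ×-dec any? λ u → reach₂? t u ×-dec T? (adj G u w)

  reach₁-level : ∀ {t v} → Reach₁ t v → level v ≡ 1
  reach₁-level {zero}  = proj₁
  reach₁-level {suc t} = proj₁

  data Reached (x : V G) : Set where
    at₀ : level x ≡ 0 → Reached x
    at₁ : ∀ {t} → Reach₁ t x → Reached x
    at₂ : ∀ {t} → Reach₂ t x → Reached x

  reached-≢3 : ∀ {x} → Reached x → level x ≢ 3
  reached-≢3 (at₀ x₀) x₃ = 0≢1+n (trans (sym x₀) x₃)
  reached-≢3 (at₁ r)  x₃ = contradiction (trans (sym (reach₁-level r)) x₃) λ ()
  reached-≢3 (at₂ r)  x₃ = contradiction (trans (sym (proj₁ r)) x₃) λ ()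

  reached-step : ∀ {x y} → Reached x → Edge G x y → Reached y ⊎ ∃[ t ] Reach₃ t y
  reached-step {x} (at₀ x₀) e with level-edge e
  ... | inj₁ y↑ = inj₁ (at₁ {t = zero} (trans y↑ (cong suc x₀) , x , x₀ , e))
  ... | inj₂ x↑ = contradiction (trans (sym x₀) x↑) 0≢1+n
  reached-step {x} (at₁ {t} r) e with level-edge e
  ... | inj₁ y↑ = inj₁ (at₂ {t = t} (trans y↑ (cong suc (reach₁-level r)) , x , r , e))
  ... | inj₂ x↑ = inj₁ (at₀ (suc-injective (trans (sym x↑) (reach₁-level r))))
  reached-step {x} (at₂ {t} r) e with level-edge e
  ... | inj₁ y↑ = inj₂ (t , trans y↑ (cong suc (proj₁ r)) , x , r , e)
  ... | inj₂ x↑ = inj₁ (at₁ {t = suc t} (suc-injective (trans (sym x↑) (proj₁ r)) , x , r , e))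

  crossing : ∀ {x y} → Reached x → Walk G x y → level y ≡ 3 → ∃[ t ] CrossesAt t
  crossing r here y₃ = ⊥-elim (reached-≢3 r y₃)
  crossing r (step e rest) y₃ with reached-step r e
  ... | inj₁ r′       = crossing r′ rest y₃
  ... | inj₂ (t , r₃) = t , _ , r₃

  -- depthᵢ v is the least t ≤ k with Reachᵢ t v, and k if there is none.
  module Depth (k : ℕ) where

    private
      stage₁? : ∀ v → Decidable (λ t → Reach₁ t v)
      stage₁? v t = reach₁? t v

      stage₂? : ∀ v → Decidable (λ t → Reach₂ t v)
      stage₂? v t = reach₂? t v

    depth₁ depth₂ : V G → ℕ
    depth₁ v = leastUpTo (stage₁? v) k
    depth₂ v = leastUpTo (stage₂? v) k

    depth₁-≤ : ∀ v → depth₁ v ≤ k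
    depth₁-≤ v = leastUpTo-≤ (stage₁? v) k

    depth₁-start : ∀ {x y} → level x ≡ 0 → Edge G x y → level y ≡ 1 → depth₁ y ≡ 0
    depth₁-start x₀ e y₁ = n≤0⇒n≡0 (leastUpTo-minimal (stage₁? _) k (y₁ , _ , x₀ , e))

    depth-near : ∀ {x y} → level x ≡ 1 → level y ≡ 2 → Edge G x y →
                 depth₂ y ≤ depth₁ x × depth₁ x ≤ suc (depth₂ y)
    depth-near {x} {y} x₁ y₂ e = j≤i , i≤1+j
      where
        j≤i : depth₂ y ≤ depth₁ x
        j≤i with leastUpTo-found (stage₁? x) k
        ... | inj₁ r   = leastUpTo-minimal (stage₂? y) k (y₂ , x , r , e)
        ... | inj₂ i≡k = subst (depth₂ y ≤_) (sym i≡k) (leastUpTo-≤ (stage₂? y) k)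

        i≤1+j : depth₁ x ≤ suc (depth₂ y)
        i≤1+j with leastUpTo-found (stage₂? y) k
        ... | inj₁ r   = leastUpTo-minimal (stage₁? x) k (x₁ , y , r , Edge-sym G e)
        ... | inj₂ j≡k = subst (λ j → depth₁ x ≤ suc j) (sym j≡k) (m≤n⇒m≤1+n (depth₁-≤ x))

    depth₂-top : (∀ t → t < k → ¬ CrossesAt t) →
                 ∀ {x y} → Edge G x y → level y ≡ 3 → depth₂ x ≡ k
    depth₂-top shorter {x} {y} e y₃ with leastUpTo-found (stage₂? x) k
    ... | inj₂ j≡k = j≡k
    ... | inj₁ r with m≤n⇒m<n∨m≡n (leastUpTo-≤ (stage₂? x) k)
    ...   | inj₁ j<k = ⊥-elim (shorter _ j<k (y , y₃ , x , r , e))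
    ...   | inj₂ j≡k = j≡k

  -- Read from the top, the zigzag is  high 0 = u, low 0, high 1, low 1, …, high t,
  -- low t, bottom;  past index t both sequences stay constant.
  record Zigzag (t : ℕ) (u : V G) : Set where
    field
      high low     : ℕ → V G
      bottom       : V G
      high-zero    : high 0 ≡ u
      high-level   : ∀ m → level (high m) ≡ 2
      low-level    : ∀ m → level (low m) ≡ 1
      bottom-level : level bottom ≡ 0
      low-high     : ∀ m → Edge G (low m) (high m)
      high-low     : ∀ m → Edge G (high (suc m)) (low m)
      bottom-low   : Edge G bottom (low t)

    low-high-near : ∀ {i j} → j ≤ i → i ≤ suc j → i ≤ t → Edge G (low (t ∸ i)) (high (t ∸ j))
    low-high-near {i} {j} j≤i i≤1+j i≤t with span≤1 j≤i i≤1+j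
    ... | inj₁ refl = low-high (t ∸ j)
    ... | inj₂ refl =
      subst (λ m → Edge G (low (t ∸ i)) (high m)) (sym (m∸n≡1+[m∸1+n] i≤t))
            (Edge-sym G (high-low (t ∸ i)))

  zigzag : ∀ t {u} → Reach₂ t u → Zigzag t u
  zigzag zero {u} (u₂ , v , (v₁ , a , a₀ , av) , vu) = record
    { high = λ _ → u ; low = λ _ → v ; bottom = a
    ; high-zero = refl ; high-level = λ _ → u₂ ; low-level = λ _ → v₁ ; bottom-level = a₀
    ; low-high = λ _ → vu ; high-low = λ _ → Edge-sym G vu ; bottom-low = av }
  zigzag (suc t) {u} (u₂ , v , (v₁ , u′ , r , u′v) , vu) = record
    { high = λ { zero → u ; (suc m) → high m }
    ; low = λ { zero → v ; (suc m) → low m }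
    ; bottom = bottom
    ; high-zero = refl
    ; high-level = λ { zero → u₂ ; (suc m) → high-level m }
    ; low-level = λ { zero → v₁ ; (suc m) → low-level m }
    ; bottom-level = bottom-level
    ; low-high = λ { zero → vu ; (suc m) → low-high m }
    ; high-low = λ { zero → subst (λ x → Edge G x v) (sym high-zero) u′v
                   ; (suc m) → high-low m }
    ; bottom-low = bottom-low }
    where open Zigzag (zigzag t r)

module _ {A B : Graph} {f : Hom A P3} {g : Hom B P3} where
  private
    module A = Levelled A f
    module B = Levelled B g

  sliceHom-fromEmpty : ¬ V A → SliceHom (A , f) (B , g)
  sliceHom-fromEmpty ∄a = hom (⊥-elim ∘ ∄a) (λ a _ _ → ⊥-elim (∄a a)) , λ a → ⊥-elim (∄a a)

  sliceHom-fromUpward :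
    (ψ : V A → V B) → (∀ a → B.level (ψ a) ≡ A.level a) →
    (∀ {x y} → Edge A x y → A.level y ≡ suc (A.level x) → Edge B (ψ x) (ψ y)) →
    SliceHom (A , f) (B , g)
  sliceHom-fromUpward ψ ψ-level ψ-up = hom ψ ψ-edge , λ a → toℕ-injective (sym (ψ-level a))
    where
      ψ-edge : ∀ x y → Edge A x y → Edge B (ψ x) (ψ y)
      ψ-edge x y e with A.level-edge e
      ... | inj₁ y↑ = ψ-up e y↑
      ... | inj₂ x↑ = Edge-sym B (ψ-up (Edge-sym A e) x↑)

  sliceHom-viaAscent : ∀ {lo hi} → (∀ a → lo ≤ A.level a × A.level a ≤ hi) →
                       B.Ascends lo hi → SliceHom (A , f) (B , g)
  sliceHom-viaAscent bounds (x , y , r , refl , refl) = sliceHom-fromUpward ψ ψ-level ψ-up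
    where
      height : V A → ℕ
      height a = A.level a ∸ B.level x

      height+lo : ∀ a → height a + B.level x ≡ A.level a
      height+lo a = m∸n+n≡m (proj₁ (bounds a))

      ψ : V A → V B
      ψ a = B.rung r (height a)

      ψ-level : ∀ a → B.level (ψ a) ≡ A.level a
      ψ-level a =
        trans (B.rung-level r (height a) (subst (_≤ _) (sym (height+lo a)) (proj₂ (bounds a))))
              (height+lo a)

      ψ-up : ∀ {u v} → Edge A u v → A.level v ≡ suc (A.level u) → Edge B (ψ u) (ψ v)
      ψ-up {u} {v} _ v↑ =
        subst (λ d → Edge B (ψ u) (B.rung r d)) (sym height-v)
              (B.rung-edge r (height u) (subst (_≤ _) (sym below-v) (proj₂ (bounds v))))
        where
          height-v : height v ≡ suc (height u)
          height-v = trans (cong (_∸ B.level x) v↑) (+-∸-assoc 1 (proj₁ (bounds u)))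

          below-v : suc (height u) + B.level x ≡ A.level v
          below-v = trans (cong suc (height+lo u)) (sym v↑)

  sliceHom-ifNarrow : Connected B → ImageSub (A , f) (B , g) →
                      ∀ {a₀ a₁} → (∀ a → A.level a₀ ≤ A.level a × A.level a ≤ A.level a₁) →
                      A.level a₁ ≤ 2 + A.level a₀ → SliceHom (A , f) (B , g)
  sliceHom-ifNarrow cB img {a₀} {a₁} bounds narrow =
    sliceHom-viaAscent bounds
      (B.ascends (cB (proj₁ (img a₀)) (proj₁ (img a₁))) (image-level a₀) (image-level a₁)
                 (proj₁ (bounds a₁)) narrow)
    where
      image-level : ∀ a → B.level (proj₁ (img a)) ≡ A.level a
      image-level a = cong toℕ (proj₂ (img a))

  sliceHom-intoZigzag : ∀ {k} → B.CrossesAt k → (∀ t → t < k → ¬ A.CrossesAt t) →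
                        SliceHom (A , f) (B , g)
  sliceHom-intoZigzag {k} (w , w₃ , u , r , uw) shorter = sliceHom-fromUpward ψ ψ-level ψ-up
    where
      open B.Zigzag (B.zigzag k r)
      open A.Depth k

      at : ℕ → V A → V B
      at 0 _ = bottom
      at 1 a = low (k ∸ depth₁ a)
      at 2 a = high (k ∸ depth₂ a)
      at _ _ = w

      ψ : V A → V B
      ψ a = at (A.level a) a

      at-level : ∀ l a → l < 4 → B.level (at l a) ≡ l
      at-level 0 _ _ = bottom-level
      at-level 1 _ _ = low-level _
      at-level 2 _ _ = high-level _
      at-level 3 _ _ = w₃
      at-level (suc (suc (suc (suc _)))) _ (s≤s (s≤s (s≤s (s≤s ()))))

      ψ-level : ∀ a → B.level (ψ a) ≡ A.level a
      ψ-level a = at-level (A.level a) a (A.level<4 a)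

      up-edge : ∀ l {x y} → A.level x ≡ l → A.level y ≡ suc l → Edge A x y →
                Edge B (at l x) (at (suc l) y)
      up-edge 0 x₀ y₁ e rewrite depth₁-start x₀ e y₁ = bottom-low
      up-edge 1 x₁ y₂ e =
        let j≤i , i≤1+j = depth-near x₁ y₂ e in low-high-near j≤i i≤1+j (depth₁-≤ _)
      up-edge 2 _ y₃ e rewrite depth₂-top shorter e y₃ | n∸n≡0 k | high-zero = uw
      up-edge (suc (suc (suc l))) {y = y} _ y↑ _ =
        contradiction (subst (_< 4) y↑ (A.level<4 y)) λ { (s≤s (s≤s (s≤s (s≤s ())))) }

      ψ-up : ∀ {x y} → Edge A x y → A.level y ≡ suc (A.level x) → Edge B (ψ x) (ψ y)
      ψ-up {x} {y} e y↑ =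
        subst (λ l → Edge B (ψ x) (at l y)) (sym y↑) (up-edge (A.level x) refl y↑ e)

module _ {A B : Graph} {f : Hom A P3} {g : Hom B P3} where
  private
    module A = Levelled A f
    module B = Levelled B g

  comparable-ifCrossing : ∀ {t} → A.CrossesAt t →
                          SliceHom (A , f) (B , g) ⊎ SliceHom (B , g) (A , f)
  comparable-ifCrossing c with least-witness (λ t → A.crossesAt? t ⊎-dec B.crossesAt? t) (inj₁ c)
  ... | k , inj₁ cA , shortest =
    inj₂ (sliceHom-intoZigzag {B} {A} {g} {f} cA (λ s s<k → shortest s s<k ∘ inj₂))
  ... | k , inj₂ cB , shortest =
    inj₁ (sliceHom-intoZigzag cB (λ s s<k → shortest s s<k ∘ inj₁))

corollary4p4 : (A B : Graph) (f : Hom A P3) (g : Hom B P3) →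
    Connected A → Connected B → ImageSub (A , f) (B , g) →
    SliceHom (A , f) (B , g) ⊎ SliceHom (B , g) (A , f)
corollary4p4 A B f g cA cB img =
  [ comparable , (λ ∄a → inj₁ (sliceHom-fromEmpty {f = f} {g = g} ∄a)) ]′ (vertex? A)
  where
    open Levelled A f

    comparable : V A → SliceHom (A , f) (B , g) ⊎ SliceHom (B , g) (A , f)
    comparable a with level-range a
    ... | a₀ , a₁ , bounds with narrow-or-full (level<4 a₁)
    ...   | inj₁ narrow = inj₁ (sliceHom-ifNarrow {f = f} {g = g} cB img bounds narrow)
    ...   | inj₂ (a₀-bottom , a₁-top) =
      comparable-ifCrossing {f = f} {g = g} (proj₂ (crossing (at₀ a₀-bottom) (cA a₀ a₁) a₁-top))
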